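{- Let $q$ be a prime power with $q\equiv5\pmod 8$, and let $a_q=q+1-\#E(\mathbb{F}_q)$ be the trace of Frobenius of $E:y^2=x^3-x$ over $\mathbb{F}_q$. Then $\left|T_{\mathbb{F}_q}^{\mathrm{adv}_\infty}\right|=\frac{q-a_q-7}{4}$.
   Context: For a field $K$ of characteristic not $2$, let $T_K=K\setminus\{0,1,-1\}$. For $k_1,k_2\in T_K$ write $k_1\overset{k}{\mapsto}k_2$ if $(1+k_1)^2k_2^2=4k_1$. For $n\ge0$, $T_K^{\mathrm{adv}_n}$ is the set of $k_0\in T_K$ for which there exist $k_1,\dots,k_n\in T_K$ with $k_0\overset{k}{\mapsto}k_1\overset{k}{\mapsto}\cdots\overset{k}{\mapsto}k_n$, and $T_K^{\mathrm{adv}_\infty}=\bigcap_{n\ge0}T_K^{\mathrm{adv}_n}$. $\#E(\mathbb{F}_q)$ counts projective points including the point at infinity. -}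

module Defs where

open import Level using (0ℓ)
open import Data.Nat as ℕ using (ℕ; zero; suc)
open import Data.Nat.Primality using (Prime)
open import Data.Fin using (Fin)
open import Data.Product using (Σ; ∃; _×_; _,_)
open import Relation.Nullary using (¬_)
open import Relation.Binary.PropositionalEquality using (_≡_)
open import Algebra.Structures using (IsCommutativeRing)
open import Function.Bundles using (_↔_)
open import Function.Definitions using (Injective)

IsPrimePower : ℕ → Set
IsPrimePower q = Σ ℕ λ p → Σ ℕ λ k → Prime p × q ≡ p ℕ.^ suc k

record FiniteField (q : ℕ) : Set₁ where
  infixl 6 _+_ _-_
  infixl 7 _*_
  field
    Carrier : Set
    _+_ _*_ : Carrier → Carrier → Carrier
    -_ : Carrier → Carrier
    0# 1# : Carrier
    isCommutativeRing : IsCommutativeRing _≡_ _+_ _*_ -_ 0# 1#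
    0≢1 : ¬ (0# ≡ 1#)
    inverse : ∀ x → ¬ (x ≡ 0#) → Σ Carrier λ y → x * y ≡ 1#
    enumeration : Carrier ↔ Fin q

  _-_ : Carrier → Carrier → Carrier
  x - y = x + (- y)

  2# 4# : Carrier
  2# = 1# + 1#
  4# = 2# + 2#

HasSize : {A : Set} → (A → Set) → ℕ → Set
HasSize {A} P m = Σ (Fin m → A) λ f →
  (∀ i → P (f i)) × Injective _≡_ _≡_ f × (∀ x → P x → ∃ λ i → f i ≡ x)

module FieldDefs {q : ℕ} (F : FiniteField q) where
  open FiniteField F

  InT : Carrier → Set
  InT k = ¬ (k ≡ 0#) × ¬ (k ≡ 1#) × ¬ (k ≡ - 1#)

  _↦_ : Carrier → Carrier → Set
  k₁ ↦ k₂ = InT k₁ × InT k₂ ×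
    ((1# + k₁) * (1# + k₁) * (k₂ * k₂) ≡ 4# * k₁)

  Adv : ℕ → Carrier → Set
  Adv zero k = InT k
  Adv (suc n) k = Σ Carrier λ k' → (k ↦ k') × Adv n k'

  -- T_K^{adv_∞} = ⋂ₙ T_K^{adv_n}
  AdvInf : Carrier → Set
  AdvInf k = ∀ n → Adv n k

  AffineE : Carrier × Carrier → Set
  AffineE (x , y) = y * y ≡ x * x * x - x

{-# OPTIONS --safe #-}
-- Over 𝔽_q with q ≡ 5 (mod 8) the element 2 is invertible, -1 = i² is a square and i is not, so i u is a
-- square for every non-square u; each fact follows by counting the orbits of a free action of a small group
-- (generated by x ↦ x + 1, by x ↦ -x and x ↦ x⁻¹, or by x ↦ i x) and comparing with q ≡ 5 (mod 8).
--
-- Put v(s) = 2s(1 + s²). A chain k ↦ k₁ ↦ k₂ forces k = s² with s = (1 + k)k₁/2, and then v(s) = (w(1 + k))²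
-- for w = (1 + k₁)k₂/2. Conversely, if s² ∈ T and v(s) = y², then t = y/(1 + s²) satisfies s² ↦ ±t², and as
-- v(t) v(it) = i (2t(1 - s²)/(1 + s²))², one of v(t), v(it) is again a square. So T^{adv∞} consists of the
-- k ∈ T having a square root s with v(s) a square, and every such k has exactly the two roots ±s.
--
-- The substitution s = ix turns v(s) into (1 - i)²(x³ - x). Hence the affine points of E are (0,0), (±1,0) and
-- two points (x, ±y) for each s with v(s) a nonzero square, namely s = ±1 and the roots of k ∈ T^{adv∞}:
-- #E(𝔽_q) = 1 + 3 + 2(2 + 2 |T^{adv∞}|).
module Submission where

open import Defs

open import Algebra using (CommutativeRing)
open import Algebra.Solver.Ring.AlmostCommutativeRing using (_-Raw-AlmostCommutative⟶_; fromCommutativeRing)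
open import Data.Empty using (⊥-elim)
open import Data.Fin as Fin using (Fin)
import Data.Fin.Properties as FinP
open import Data.Integer as ℤ using (ℤ; -[1+_]; _⊖_; _◃_; sign; ∣_∣)
import Data.Integer.Properties as ℤP
open import Data.Maybe using (Maybe; just; nothing)
open import Data.Nat as ℕ using (ℕ; zero; suc; _<_; _<?_)
open import Data.Nat.DivMod using ([m+kn]%n≡m%n; m≡m%n+[m/n]*n)
import Data.Nat.Properties as ℕP
open import Data.Nat.Solver using () renaming (module +-*-Solver to ℕ-Solver)
open import Data.Product using (Σ; ∃; _×_; _,_; proj₁; proj₂)
open import Data.Sign as Sign using (Sign)
open import Data.Sum as Sum using (_⊎_; inj₁; inj₂; [_,_]′)
open import Data.Unit using (tt)
open import Function using (_∘_; id; _↔_; Inverse)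
open import Function.Definitions using (Injective)
open import Level using (0ℓ)
open import Relation.Binary.Definitions using (DecidableEquality; tri<; tri≈; tri>)
open import Relation.Binary.PropositionalEquality as ≡ using (_≡_; _≢_)
open import Relation.Nullary using (¬_; Dec; yes; no; contradiction)
import Relation.Nullary.Decidable as Dec
open import Relation.Nullary.Decidable using (¬?; _×-dec_)
open import Relation.Unary using (Pred; Decidable; U; _≐_; _∪_; _⊥_)
open import Relation.Unary.Properties using (_∩?_)

module IntegerCoefficients {c ℓ} (R : CommutativeRing c ℓ) where

  open CommutativeRing R
  open import Algebra.Properties.Ring ring using (-‿distribˡ-*; -‿involutive; -‿+-comm; -0#≈0#)
  open import Algebra.Properties.Semiring.Mult.TCOptimised semiring using (1+×; ×-homo-+; ×1-homo-*) renaming (_×_ to _×′_)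
  open import Relation.Binary.Reasoning.Setoid setoid

  -- With the optimised _×′_, ⟦ + 1 ⟧ℤ and ⟦ + 2 ⟧ℤ are definitionally 1# and 1# + 1#.
  ⟦_⟧ℤ : ℤ → Carrier
  ⟦ ℤ.+ n ⟧ℤ    = n ×′ 1#
  ⟦ -[1+ n ] ⟧ℤ = - (suc n ×′ 1#)

  ⟦⟧-⊖ : ∀ m n → ⟦ m ⊖ n ⟧ℤ ≈ m ×′ 1# - n ×′ 1#
  ⟦⟧-⊖ zero    zero    = sym (trans (+-identityˡ _) -0#≈0#)
  ⟦⟧-⊖ (suc m) zero    = sym (trans (+-congˡ -0#≈0#) (+-identityʳ _))
  ⟦⟧-⊖ zero    (suc n) = sym (+-identityˡ _)
  ⟦⟧-⊖ (suc m) (suc n) = begin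
    ⟦ suc m ⊖ suc n ⟧ℤ         ≡⟨ ≡.cong ⟦_⟧ℤ (ℤP.[1+m]⊖[1+n]≡m⊖n m n) ⟩
    ⟦ m ⊖ n ⟧ℤ                 ≈⟨ ⟦⟧-⊖ m n ⟩
    a - b                      ≈⟨ +-identityˡ (a - b) ⟨
    0# + (a - b)               ≈⟨ +-congʳ (-‿inverseʳ 1#) ⟨
    (1# - 1#) + (a - b)        ≈⟨ +-assoc 1# (- 1#) (a - b) ⟩
    1# + (- 1# + (a - b))      ≈⟨ +-congˡ (+-assoc (- 1#) a (- b)) ⟨
    1# + ((- 1# + a) - b)      ≈⟨ +-congˡ (+-congʳ (+-comm (- 1#) a)) ⟩
    1# + ((a - 1#) - b)        ≈⟨ +-congˡ (+-assoc a (- 1#) (- b)) ⟩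
    1# + (a + (- 1# - b))      ≈⟨ +-assoc 1# a (- 1# - b) ⟨
    (1# + a) + (- 1# - b)      ≈⟨ +-congˡ (-‿+-comm 1# b) ⟩
    (1# + a) - (1# + b)        ≈⟨ +-cong (1+× m 1#) (-‿cong (1+× n 1#)) ⟨
    suc m ×′ 1# - suc n ×′ 1#  ∎
    where a = m ×′ 1#; b = n ×′ 1#

  ⟦⟧-+ : ∀ i j → ⟦ i ℤ.+ j ⟧ℤ ≈ ⟦ i ⟧ℤ + ⟦ j ⟧ℤ
  ⟦⟧-+ (ℤ.+ m)  (ℤ.+ n)  = ×-homo-+ 1# m n
  ⟦⟧-+ (ℤ.+ m)  -[1+ n ] = ⟦⟧-⊖ m (suc n)
  ⟦⟧-+ -[1+ m ] (ℤ.+ n)  = trans (⟦⟧-⊖ n (suc m)) (+-comm _ _)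
  ⟦⟧-+ -[1+ m ] -[1+ n ] = begin
    - (suc (suc (m ℕ.+ n)) ×′ 1#)       ≡⟨ ≡.cong (λ k → - (suc k ×′ 1#)) (ℕP.+-suc m n) ⟨
    - ((suc m ℕ.+ suc n) ×′ 1#)         ≈⟨ -‿cong (×-homo-+ 1# (suc m) (suc n)) ⟩
    - (suc m ×′ 1# + suc n ×′ 1#)       ≈⟨ -‿+-comm _ _ ⟨
    - (suc m ×′ 1#) + - (suc n ×′ 1#)   ∎

  ⟦⟧-neg : ∀ i → ⟦ ℤ.- i ⟧ℤ ≈ - ⟦ i ⟧ℤ
  ⟦⟧-neg (ℤ.+ zero)  = sym -0#≈0#
  ⟦⟧-neg (ℤ.+ suc n) = refl
  ⟦⟧-neg -[1+ n ]    = sym (-‿involutive _)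

  ⟦_⟧± : Sign → Carrier
  ⟦ Sign.+ ⟧± = 1#
  ⟦ Sign.- ⟧± = - 1#

  ⟦⟧±-* : ∀ s t → ⟦ s Sign.* t ⟧± ≈ ⟦ s ⟧± * ⟦ t ⟧±
  ⟦⟧±-* Sign.+ t      = sym (*-identityˡ _)
  ⟦⟧±-* Sign.- Sign.+ = sym (*-identityʳ _)
  ⟦⟧±-* Sign.- Sign.- = begin
    1#                ≈⟨ -‿involutive 1# ⟨
    - (- 1#)          ≈⟨ -‿cong (*-identityˡ (- 1#)) ⟨
    - (1# * - 1#)     ≈⟨ -‿distribˡ-* 1# (- 1#) ⟩
    - 1# * - 1#       ∎

  ⟦⟧-◃ : ∀ s n → ⟦ s ◃ n ⟧ℤ ≈ ⟦ s ⟧± * (n ×′ 1#)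
  ⟦⟧-◃ s      zero    = sym (zeroʳ _)
  ⟦⟧-◃ Sign.+ (suc n) = sym (*-identityˡ _)
  ⟦⟧-◃ Sign.- (suc n) = trans (-‿cong (sym (*-identityˡ _))) (-‿distribˡ-* _ _)

  ⟦⟧-sign-abs : ∀ i → ⟦ i ⟧ℤ ≈ ⟦ sign i ⟧± * (∣ i ∣ ×′ 1#)
  ⟦⟧-sign-abs i = begin
    ⟦ i ⟧ℤ                         ≡⟨ ≡.cong ⟦_⟧ℤ (ℤP.◃-inverse i) ⟨
    ⟦ sign i ◃ ∣ i ∣ ⟧ℤ            ≈⟨ ⟦⟧-◃ (sign i) ∣ i ∣ ⟩
    ⟦ sign i ⟧± * (∣ i ∣ ×′ 1#)    ∎

  ⟦⟧-* : ∀ i j → ⟦ i ℤ.* j ⟧ℤ ≈ ⟦ i ⟧ℤ * ⟦ j ⟧ℤ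
  ⟦⟧-* i j = begin
    ⟦ (sign i Sign.* sign j) ◃ (∣ i ∣ ℕ.* ∣ j ∣) ⟧ℤ         ≈⟨ ⟦⟧-◃ (sign i Sign.* sign j) (∣ i ∣ ℕ.* ∣ j ∣) ⟩
    ⟦ sign i Sign.* sign j ⟧± * ((∣ i ∣ ℕ.* ∣ j ∣) ×′ 1#)   ≈⟨ *-cong (⟦⟧±-* (sign i) (sign j)) (×1-homo-* ∣ i ∣ ∣ j ∣) ⟩
    (s * t) * (m * n)                                       ≈⟨ *-assoc s t (m * n) ⟩
    s * (t * (m * n))                                       ≈⟨ *-congˡ (x∙yz≈y∙xz t m n) ⟩
    s * (m * (t * n))                                       ≈⟨ *-assoc s m (t * n) ⟨
    (s * m) * (t * n)                                       ≈⟨ *-cong (⟦⟧-sign-abs i) (⟦⟧-sign-abs j) ⟨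
    ⟦ i ⟧ℤ * ⟦ j ⟧ℤ                                         ∎
    where
    s = ⟦ sign i ⟧±; t = ⟦ sign j ⟧±; m = ∣ i ∣ ×′ 1#; n = ∣ j ∣ ×′ 1#
    open import Algebra.Properties.CommutativeSemigroup *-commutativeSemigroup using (x∙yz≈y∙xz)

  ⟦⟧-morphism : ℤ.+-*-rawRing -Raw-AlmostCommutative⟶ fromCommutativeRing R
  ⟦⟧-morphism = record
    { ⟦_⟧ = ⟦_⟧ℤ ; +-homo = ⟦⟧-+ ; *-homo = ⟦⟧-* ; -‿homo = ⟦⟧-neg ; 0-homo = refl ; 1-homo = refl }

  ⟦⟧-≟ : ∀ i j → Maybe (⟦ i ⟧ℤ ≈ ⟦ j ⟧ℤ)
  ⟦⟧-≟ i j with i ℤ.≟ j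
  ... | yes ≡.refl = just refl
  ... | no _       = nothing

  open import Algebra.Solver.Ring ℤ.+-*-rawRing (fromCommutativeRing R) ⟦⟧-morphism ⟦⟧-≟ public

module Counting where

  open ≡ using (refl; sym; trans; cong; subst)

  Fin-injective⇒surjective : ∀ {n} (h : Fin n → Fin n) → Injective _≡_ _≡_ h → ∀ j → ∃ λ k → h k ≡ j
  Fin-injective⇒surjective {zero}  h h-injective ()
  Fin-injective⇒surjective {suc n} h h-injective j with FinP.any? (λ k → h k FinP.≟ j)
  ... | yes hit = hit
  ... | no miss = contradiction (FinP.injective⇒≤ {f = h′} h′-injective) ℕP.1+n≰n
    where
    j≢h : ∀ k → j ≢ h k
    j≢h k j≡hk = miss (k , sym j≡hk)
    h′ : Fin (suc n) → Fin n
    h′ k = Fin.punchOut (j≢h k)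
    h′-injective : Injective _≡_ _≡_ h′
    h′-injective e = h-injective (FinP.punchOut-injective (j≢h _) (j≢h _) e)

  module _ {A : Set} where

    HasSize-resp : {P Q : Pred A 0ℓ} {n : ℕ} → P ≐ Q → HasSize P n → HasSize Q n
    HasSize-resp (P⊆Q , Q⊆P) (f , f-∈ , f-injective , f-onto) =
      f , (λ i → P⊆Q (f-∈ i)) , f-injective , (λ x qx → f-onto x (Q⊆P qx))

    position : {P : Pred A 0ℓ} {n : ℕ} → HasSize P n → ∀ {x} → P x → Fin n
    position (_ , _ , _ , f-onto) px = proj₁ (f-onto _ px)

    position-correct : {P : Pred A 0ℓ} {n : ℕ} (e : HasSize P n) → ∀ {x} (px : P x) → proj₁ e (position e px) ≡ x
    position-correct (_ , _ , _ , f-onto) px = proj₂ (f-onto _ px)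

    HasSize-≤ : {P : Pred A 0ℓ} {m n : ℕ} → HasSize P n →
      (h : Fin m → A) → (∀ i → P (h i)) → Injective _≡_ _≡_ h → m ℕ.≤ n
    HasSize-≤ e h h-∈ h-injective = FinP.injective⇒≤ {f = λ i → position e (h-∈ i)} λ {i} {j} pi≡pj →
      h-injective (trans (sym (position-correct e (h-∈ i))) (trans (cong (proj₁ e) pi≡pj) (position-correct e (h-∈ j))))

    HasSize-unique : {P : Pred A 0ℓ} {m n : ℕ} → HasSize P m → HasSize P n → m ≡ n
    HasSize-unique e@(f , f-∈ , f-injective , _) e′@(g , g-∈ , g-injective , _) =
      ℕP.≤-antisym (HasSize-≤ e′ f f-∈ f-injective) (HasSize-≤ e g g-∈ g-injective)

    HasSize-≡ : (a : A) → HasSize (_≡ a) 1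
    HasSize-≡ a = (λ _ → a) , (λ _ → refl) , (λ {i} {j} _ → Fin1-unique i j) , (λ x x≡a → Fin.zero , sym x≡a)
      where
      Fin1-unique : (i j : Fin 1) → i ≡ j
      Fin1-unique Fin.zero Fin.zero = refl

    HasSize-∪ : {P Q : Pred A 0ℓ} {m n : ℕ} → HasSize P m → HasSize Q n → P ⊥ Q → HasSize (P ∪ Q) (m ℕ.+ n)
    HasSize-∪ {P} {Q} {m} {n} (f , f-∈ , f-injective , f-onto) (g , g-∈ , g-injective , g-onto) disjoint =
      [f,g] ∘ Fin.splitAt m , ∈-∪ ∘ Fin.splitAt m , injective , onto
      where
      [f,g] : Fin m ⊎ Fin n → A
      [f,g] = [ f , g ]′
      ∈-∪ : ∀ s → (P ∪ Q) ([f,g] s)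
      ∈-∪ (inj₁ i) = inj₁ (f-∈ i)
      ∈-∪ (inj₂ j) = inj₂ (g-∈ j)
      [f,g]-injective : ∀ s t → [f,g] s ≡ [f,g] t → s ≡ t
      [f,g]-injective (inj₁ i) (inj₁ j) e = cong inj₁ (f-injective e)
      [f,g]-injective (inj₁ i) (inj₂ j) e = ⊥-elim (disjoint (f-∈ i , subst Q (sym e) (g-∈ j)))
      [f,g]-injective (inj₂ i) (inj₁ j) e = ⊥-elim (disjoint (f-∈ j , subst Q e (g-∈ i)))
      [f,g]-injective (inj₂ i) (inj₂ j) e = cong inj₂ (g-injective e)
      injective : Injective _≡_ _≡_ ([f,g] ∘ Fin.splitAt m)
      injective {k} {l} e = trans (sym (FinP.join-splitAt m n k))
        (trans (cong (Fin.join m n) ([f,g]-injective (Fin.splitAt m k) (Fin.splitAt m l) e)) (FinP.join-splitAt m n l))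
      onto-from : ∀ {x} s → [f,g] s ≡ x → ∃ λ k → [f,g] (Fin.splitAt m k) ≡ x
      onto-from s e = Fin.join m n s , trans (cong [f,g] (FinP.splitAt-join m n s)) e
      onto : ∀ x → (P ∪ Q) x → ∃ λ k → [f,g] (Fin.splitAt m k) ≡ x
      onto x (inj₁ px) = let (i , fi≡x) = f-onto x px in onto-from (inj₁ i) fi≡x
      onto x (inj₂ qx) = let (j , gj≡x) = g-onto x qx in onto-from (inj₂ j) gj≡x

  record Bijection {A B : Set} (P : Pred A 0ℓ) (Q : Pred B 0ℓ) : Set where
    field
      to           : A → B
      to-∈         : ∀ {x} → P x → Q (to x)
      to-injective : ∀ {x y} → P x → P y → to x ≡ to y → x ≡ y
      to-onto      : ∀ {y} → Q y → ∃ λ x → P x × to x ≡ y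

  module _ {A B : Set} {P : Pred A 0ℓ} {Q : Pred B 0ℓ} (φ : Bijection P Q) where
    open Bijection φ

    HasSize-bijection : ∀ {n} → HasSize P n → HasSize Q n
    HasSize-bijection (f , f-∈ , f-injective , f-onto) =
      to ∘ f , to-∈ ∘ f-∈ , (λ e → f-injective (to-injective (f-∈ _) (f-∈ _) e)) , onto
      where
      onto : ∀ y → Q y → ∃ λ i → to (f i) ≡ y
      onto y qy = let (x , px , to-x≡y) = to-onto qy; (i , fi≡x) = f-onto x px in
        i , trans (cong to fi≡x) to-x≡y

    HasSize-bijection⁻ : ∀ {n} → HasSize Q n → HasSize P n
    HasSize-bijection⁻ {n} (g , g-∈ , g-injective , g-onto) = f , f-∈ , f-injective , f-onto
      where
      preimage : ∀ i → ∃ λ x → P x × to x ≡ g i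
      preimage i = to-onto (g-∈ i)
      f : Fin n → A
      f i = proj₁ (preimage i)
      f-∈ : ∀ i → P (f i)
      f-∈ i = proj₁ (proj₂ (preimage i))
      to-f : ∀ i → to (f i) ≡ g i
      to-f i = proj₂ (proj₂ (preimage i))
      f-injective : Injective _≡_ _≡_ f
      f-injective {i} {j} e = g-injective (trans (sym (to-f i)) (trans (cong to e) (to-f j)))
      f-onto : ∀ x → P x → ∃ λ i → f i ≡ x
      f-onto x px = let (i , gi≡to-x) = g-onto (to x) (to-∈ px) in
        i , to-injective (f-∈ i) px (trans (to-f i) gi≡to-x)

  injection⇒bijection : {A B : Set} {P : Pred A 0ℓ} {Q : Pred B 0ℓ} {n : ℕ} → HasSize P n → HasSize Q n →
    (f : A → B) → (∀ {x} → P x → Q (f x)) → (∀ {x y} → P x → P y → f x ≡ f y → x ≡ y) → Bijection P Q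
  injection⇒bijection {P = P} {Q} {n} e@(a , a-∈ , a-injective , _) e′@(b , _ , _ , _) f f-∈ f-injective =
    record { to = f ; to-∈ = f-∈ ; to-injective = f-injective ; to-onto = onto }
    where
    h : Fin n → Fin n
    h i = position e′ (f-∈ (a-∈ i))
    b∘h : ∀ i → b (h i) ≡ f (a i)
    b∘h i = position-correct e′ (f-∈ (a-∈ i))
    h-injective : Injective _≡_ _≡_ h
    h-injective {i} {j} e = a-injective (f-injective (a-∈ i) (a-∈ j) (trans (sym (b∘h i)) (trans (cong b e) (b∘h j))))
    onto : ∀ {y} → Q y → ∃ λ x → P x × f x ≡ y
    onto qy = let (k , hk≡j) = Fin-injective⇒surjective h h-injective (position e′ qy) in
      a k , a-∈ k , trans (sym (b∘h k)) (trans (cong b hk≡j) (position-correct e′ qy))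

  HasSize-Fin : ∀ n {P : Pred (Fin n) 0ℓ} → Decidable P → ∃ (HasSize P)
  HasSize-Fin zero    P? = 0 , (λ ()) , (λ ()) , (λ { {()} }) , (λ ())
  HasSize-Fin (suc n) {P} P? with HasSize-Fin n (P? ∘ Fin.suc) | P? Fin.zero
  ... | m , f , f-∈ , f-injective , f-onto | yes p0 = suc m , g , g-∈ , g-injective , g-onto
    where
    g : Fin (suc m) → Fin (suc n)
    g Fin.zero    = Fin.zero
    g (Fin.suc i) = Fin.suc (f i)
    g-∈ : ∀ i → P (g i)
    g-∈ Fin.zero    = p0
    g-∈ (Fin.suc i) = f-∈ i
    g-injective : Injective _≡_ _≡_ g
    g-injective {Fin.zero}  {Fin.zero}  _ = refl
    g-injective {Fin.suc i} {Fin.suc j} e = cong Fin.suc (f-injective (FinP.suc-injective e))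
    g-onto : ∀ x → P x → ∃ λ i → g i ≡ x
    g-onto Fin.zero    _  = Fin.zero , refl
    g-onto (Fin.suc x) px = let (i , fi≡x) = f-onto x px in Fin.suc i , cong Fin.suc fi≡x
  ... | m , f , f-∈ , f-injective , f-onto | no ¬p0 =
    m , Fin.suc ∘ f , f-∈ , f-injective ∘ FinP.suc-injective , g-onto
    where
    g-onto : ∀ x → P x → ∃ λ i → Fin.suc (f i) ≡ x
    g-onto Fin.zero    p0 = contradiction p0 ¬p0
    g-onto (Fin.suc x) px = let (i , fi≡x) = f-onto x px in i , cong Fin.suc fi≡x

  module Enumeration {A : Set} {q : ℕ} (enumeration : A ↔ Fin q) where
    open Inverse enumeration using (to; from; strictlyInverseˡ; strictlyInverseʳ)

    index : A → ℕ
    index = Fin.toℕ ∘ to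

    to-injective : ∀ {x y} → to x ≡ to y → x ≡ y
    to-injective {x} {y} e = trans (sym (strictlyInverseʳ x)) (trans (cong from e) (strictlyInverseʳ y))

    index-injective : ∀ {x y} → index x ≡ index y → x ≡ y
    index-injective = to-injective ∘ FinP.toℕ-injective

    infix 4 _≟_
    _≟_ : DecidableEquality A
    x ≟ y = Dec.map′ to-injective (cong to) (to x FinP.≟ to y)

    ∃? : {P : Pred A 0ℓ} → Decidable P → Dec (∃ P)
    ∃? {P} P? = Dec.map′ (λ (i , p) → from i , p) (λ (x , p) → to x , subst P (sym (strictlyInverseʳ x)) p)
                         (FinP.any? (P? ∘ from))

    HasSize-U : HasSize U q
    HasSize-U = from , _ , (λ e → trans (sym (strictlyInverseˡ _)) (trans (cong to e) (strictlyInverseˡ _))) ,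
                (λ x _ → to x , strictlyInverseʳ x)

    HasSize-decidable : {P : Pred A 0ℓ} → Decidable P → ∃ (HasSize P)
    HasSize-decidable {P} P? = let (m , e) = HasSize-Fin q (P? ∘ from) in m , HasSize-bijection from-bijection e
      where
      from-bijection : Bijection (P ∘ from) P
      from-bijection = record
        { to = from ; to-∈ = id
        ; to-injective = λ _ _ e → trans (sym (strictlyInverseˡ _)) (trans (cong to e) (strictlyInverseˡ _))
        ; to-onto = λ {x} px → to x , subst P (sym (strictlyInverseʳ x)) px , strictlyInverseʳ x }

module FreeInvolutions where

  open ≡ using (refl; sym; trans; cong; subst)
  open ℕ-Solver using (_:+_; _:*_; _:=_; con) renaming (solve to ℕ-solve)
  open Counting

  -- κ only has to separate x from σ x; each orbit {x , σ x} is represented by its element with smaller κ.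
  module FreeInvolution {A : Set} (P : Pred A 0ℓ) (σ : A → A) (κ : A → ℕ)
    (σ-∈ : ∀ {x} → P x → P (σ x)) (σ-involutive : ∀ {x} → P x → σ (σ x) ≡ x)
    (κ-separates : ∀ {x} → P x → κ (σ x) ≢ κ x) where

    Canonical : Pred A 0ℓ
    Canonical x = P x × κ x < κ (σ x)

    ¬Canonical-σ : ∀ {x} → Canonical x → ¬ Canonical (σ x)
    ¬Canonical-σ (px , x<σx) (_ , σx<σσx) = ℕP.<-asym x<σx (subst (λ y → κ (σ _) < κ y) (σ-involutive px) σx<σσx)

    canonical : A → A
    canonical x with κ x <? κ (σ x)
    ... | yes _ = x
    ... | no  _ = σ x

    canonical-∈ : ∀ {x} → P x → Canonical (canonical x)
    canonical-∈ {x} px with κ x <? κ (σ x)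
    ... | yes x<σx = px , x<σx
    ... | no  x≮σx = σ-∈ px , subst (λ y → κ (σ x) < κ y) (sym (σ-involutive px))
                                      (ℕP.≤∧≢⇒< (ℕP.≮⇒≥ x≮σx) (κ-separates px))

    canonical-cases : ∀ x → canonical x ≡ x ⊎ canonical x ≡ σ x
    canonical-cases x with κ x <? κ (σ x)
    ... | yes _ = inj₁ refl
    ... | no  _ = inj₂ refl

    canonical-orbit : ∀ {x y} → Canonical x → y ≡ x ⊎ y ≡ σ x → canonical y ≡ x
    canonical-orbit {x} (px , x<σx) (inj₁ refl) with κ x <? κ (σ x)
    ... | yes _    = refl
    ... | no x≮σx  = contradiction x<σx x≮σx
    canonical-orbit {x} cx@(px , _) (inj₂ refl) with κ (σ x) <? κ (σ (σ x))
    ... | yes σx<σσx = contradiction (σ-∈ px , σx<σσx) (¬Canonical-σ cx)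
    ... | no  _      = σ-involutive px

    HasSize-twice : ∀ {m} → HasSize Canonical m → HasSize P (m ℕ.+ m)
    HasSize-twice e = HasSize-resp (to-P , from-P) (HasSize-∪ e (HasSize-bijection σ-bijection e) disjoint)
      where
      Upper : Pred A 0ℓ
      Upper x = P x × κ (σ x) < κ x
      σ-bijection : Bijection Canonical Upper
      σ-bijection = record
        { to           = σ
        ; to-∈         = λ (px , x<σx) → σ-∈ px , subst (λ y → κ y < κ (σ _)) (sym (σ-involutive px)) x<σx
        ; to-injective = λ (px , _) (py , _) σx≡σy →
            trans (sym (σ-involutive px)) (trans (cong σ σx≡σy) (σ-involutive py))
        ; to-onto      = λ {y} (py , σy<y) →
            σ y , (σ-∈ py , subst (λ z → κ (σ y) < κ z) (sym (σ-involutive py)) σy<y) , σ-involutive py }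
      disjoint : Canonical ⊥ Upper
      disjoint ((_ , x<σx) , (_ , σx<x)) = ℕP.<-asym x<σx σx<x
      to-P : ∀ {x} → (Canonical ∪ Upper) x → P x
      to-P (inj₁ (px , _)) = px
      to-P (inj₂ (px , _)) = px
      from-P : ∀ {x} → P x → (Canonical ∪ Upper) x
      from-P {x} px with ℕP.<-cmp (κ x) (κ (σ x))
      ... | tri< x<σx _ _ = inj₁ (px , x<σx)
      ... | tri≈ _ x≡σx _ = contradiction (sym x≡σx) (κ-separates px)
      ... | tri> _ _ σx<x = inj₂ (px , σx<x)

    HasSize-2-to-1 : {B : Set} {Q : Pred B 0ℓ} {m : ℕ} (π : A → B) →
      (∀ {x} → P x → Q (π x)) → (∀ {x} → P x → π (σ x) ≡ π x) →
      (∀ {x y} → P x → P y → π x ≡ π y → y ≡ x ⊎ y ≡ σ x) →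
      (∀ {z} → Q z → ∃ λ x → P x × π x ≡ z) →
      HasSize Q m → HasSize P (m ℕ.+ m)
    HasSize-2-to-1 {Q = Q} π π-∈ π-σ π-fibre π-onto e = HasSize-twice (HasSize-bijection⁻ π-bijection e)
      where
      π-canonical : ∀ {x} → P x → π (canonical x) ≡ π x
      π-canonical {x} px with canonical-cases x
      ... | inj₁ eq = cong π eq
      ... | inj₂ eq = trans (cong π eq) (π-σ px)
      injective : ∀ {x y} → Canonical x → Canonical y → π x ≡ π y → x ≡ y
      injective cx@(px , _) cy@(py , _) πx≡πy with π-fibre px py πx≡πy
      ... | inj₁ y≡x    = sym y≡x
      ... | inj₂ refl   = contradiction cy (¬Canonical-σ cx)
      π-bijection : Bijection Canonical Q
      π-bijection = record
        { to           = π
        ; to-∈         = π-∈ ∘ proj₁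
        ; to-injective = injective
        ; to-onto      = λ qz → let (x , px , πx≡z) = π-onto qz in
            canonical x , canonical-∈ px , trans (π-canonical px) πx≡z }

    Canonical? : Decidable P → Decidable Canonical
    Canonical? P? = P? ∩? (λ x → κ x <? κ (σ x))

    HasSize-even : ∀ {q} → A ↔ Fin q → Decidable P → ∀ {n} → HasSize P n → ∃ λ m → HasSize Canonical m × n ≡ m ℕ.+ m
    HasSize-even enumeration P? e = let (m , e⁺) = Enumeration.HasSize-decidable enumeration (Canonical? P?) in
      m , e⁺ , HasSize-unique e (HasSize-twice e⁺)

  module FreeActionOfOrder4 {A : Set} {q : ℕ} (enumeration : A ↔ Fin q) {P : Pred A 0ℓ} (P? : Decidable P)
    (σ ρ : A → A) (σ-∈ : ∀ {x} → P x → P (σ x)) (ρ-∈ : ∀ {x} → P x → P (ρ x))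
    (σ-involutive : ∀ {x} → P x → σ (σ x) ≡ x) (ρ-σ : ∀ {x} → P x → ρ (σ x) ≡ σ (ρ x))
    (ρ-square : ∀ {x} → P x → ρ (ρ x) ≡ x ⊎ ρ (ρ x) ≡ σ x)
    (σ≢id : ∀ {x} → P x → σ x ≢ x) (ρ≢id : ∀ {x} → P x → ρ x ≢ x) (ρ≢σ : ∀ {x} → P x → ρ x ≢ σ x) where

    open Enumeration enumeration using (index; index-injective)
    open FreeInvolution P σ index σ-∈ σ-involutive (λ px → σ≢id px ∘ index-injective)

    -- ρ acts on the σ-orbits; τ is this action on their canonical representatives.
    τ : A → A
    τ = canonical ∘ ρ

    τ-∈ : ∀ {x} → Canonical x → Canonical (τ x)
    τ-∈ (px , _) = canonical-∈ (ρ-∈ px)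

    ρτ : ∀ {x} → P x → ρ (τ x) ≡ x ⊎ ρ (τ x) ≡ σ x
    ρτ {x} px with canonical-cases (ρ x) | ρ-square px
    ... | inj₁ eq | inj₁ ρρ≡x = inj₁ (trans (cong ρ eq) ρρ≡x)
    ... | inj₁ eq | inj₂ ρρ≡σ = inj₂ (trans (cong ρ eq) ρρ≡σ)
    ... | inj₂ eq | inj₁ ρρ≡x = inj₂ (trans (cong ρ eq) (trans (ρ-σ (ρ-∈ px)) (cong σ ρρ≡x)))
    ... | inj₂ eq | inj₂ ρρ≡σ = inj₁ (trans (cong ρ eq) (trans (ρ-σ (ρ-∈ px)) (trans (cong σ ρρ≡σ) (σ-involutive px))))

    τ-involutive : ∀ {x} → Canonical x → τ (τ x) ≡ x
    τ-involutive cx = canonical-orbit cx (ρτ (proj₁ cx))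

    τ≢id : ∀ {x} → Canonical x → τ x ≢ x
    τ≢id {x} (px , _) τx≡x with canonical-cases (ρ x)
    ... | inj₁ eq = ρ≢id px (trans (sym eq) τx≡x)
    ... | inj₂ eq = ρ≢σ px (trans (sym (σ-involutive (ρ-∈ px))) (cong σ (trans (sym eq) τx≡x)))

    module Inner = FreeInvolution Canonical τ index τ-∈ τ-involutive (λ cx → τ≢id cx ∘ index-injective)

    HasSize-four : ∀ {n} → HasSize P n → ∃ λ m → n ≡ 4 ℕ.* m
    HasSize-four e =
      let (m , e⁺ , n≡2m) = HasSize-even enumeration P? e
          (m′ , _ , m≡2m′) = Inner.HasSize-even enumeration (Canonical? P?) e⁺ in
      m′ , trans n≡2m (trans (cong (λ k → k ℕ.+ k) m≡2m′)
                             (ℕ-solve 1 (λ m → (m :+ m) :+ (m :+ m) := con 4 :* m) refl m′))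

module FieldProperties {q : ℕ} (F : FiniteField q) where

  open FiniteField F public
  open ≡ using (refl; sym; trans; cong)
  open ≡.≡-Reasoning

  commutativeRing : CommutativeRing 0ℓ 0ℓ
  commutativeRing = record { isCommutativeRing = isCommutativeRing }

  open CommutativeRing commutativeRing public
    using (+-assoc; +-comm; +-identityʳ; -‿inverseˡ; -‿inverseʳ; *-comm; *-identityˡ; zeroˡ; zeroʳ)
  open import Algebra.Properties.Ring (CommutativeRing.ring commutativeRing) public
    using (-‿involutive; -‿injective; -0#≈0#; +-cancelˡ; x∙y⁻¹≈ε⇒x≈y; +-inverseˡ-unique)
  open IntegerCoefficients commutativeRing public using (solve; _:=_; _:+_; _:-_; _:*_; :-_; con; Polynomial)
  open Counting.Enumeration enumeration public using (index; index-injective; _≟_; ∃?; HasSize-U; HasSize-decidable)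

  -- These denote 0#, 1#, 2# and 4# = 2# + 2# definitionally, which con (ℤ.+ 4) would not.
  :0 :1 :2 :4 : ∀ {n} → Polynomial n
  :0 = con (ℤ.+ 0)
  :1 = con (ℤ.+ 1)
  :2 = con (ℤ.+ 2)
  :4 = :2 :+ :2

  x*y≡0⇒x≡0⊎y≡0 : ∀ {x y} → x * y ≡ 0# → x ≡ 0# ⊎ y ≡ 0#
  x*y≡0⇒x≡0⊎y≡0 {x} {y} xy≡0 with x ≟ 0#
  ... | yes x≡0 = inj₁ x≡0
  ... | no  x≢0 = let (x′ , xx′≡1) = inverse x x≢0 in inj₂ (begin
    y                 ≡⟨ *-identityˡ y ⟨
    1# * y            ≡⟨ cong (_* y) xx′≡1 ⟨
    (x * x′) * y      ≡⟨ solve 3 (λ x x′ y → (x :* x′) :* y := x′ :* (x :* y)) refl x x′ y ⟩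
    x′ * (x * y)      ≡⟨ cong (x′ *_) xy≡0 ⟩
    x′ * 0#           ≡⟨ zeroʳ x′ ⟩
    0#                ∎)

  *-≢0 : ∀ {x y} → x ≢ 0# → y ≢ 0# → x * y ≢ 0#
  *-≢0 x≢0 y≢0 xy≡0 = [ x≢0 , y≢0 ]′ (x*y≡0⇒x≡0⊎y≡0 xy≡0)

  x*x≡0⇒x≡0 : ∀ {x} → x * x ≡ 0# → x ≡ 0#
  x*x≡0⇒x≡0 xx≡0 = [ id , id ]′ (x*y≡0⇒x≡0⊎y≡0 xx≡0)

  x*x≢0⇒x≢0 : ∀ {x} → x * x ≢ 0# → x ≢ 0#
  x*x≢0⇒x≢0 xx≢0 refl = xx≢0 (zeroˡ 0#)

  -‿≢0 : ∀ {x} → x ≢ 0# → - x ≢ 0#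
  -‿≢0 {x} x≢0 -x≡0 = x≢0 (trans (sym (-‿involutive x)) (trans (cong -_ -x≡0) -0#≈0#))

  -1≢0 : - 1# ≢ 0#
  -1≢0 = -‿≢0 (0≢1 ∘ sym)

  1+x≢0 : ∀ {x} → x ≢ - 1# → 1# + x ≢ 0#
  1+x≢0 {x} x≢-1 1+x≡0 = x≢-1 (+-inverseˡ-unique x 1# (trans (+-comm x 1#) 1+x≡0))

  -x*-x : ∀ x → (- x) * (- x) ≡ x * x
  -x*-x = solve 1 (λ x → (:- x) :* (:- x) := x :* x) refl

  *-cancelˡ : ∀ {a x y} → a ≢ 0# → a * x ≡ a * y → x ≡ y
  *-cancelˡ {a} {x} {y} a≢0 ax≡ay with x*y≡0⇒x≡0⊎y≡0 {a} {x - y} a[x-y]≡0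
    where
    a[x-y]≡0 : a * (x - y) ≡ 0#
    a[x-y]≡0 = begin
      a * (x - y)       ≡⟨ solve 3 (λ a x y → a :* (x :- y) := a :* x :- a :* y) refl a x y ⟩
      a * x - a * y     ≡⟨ cong (_- a * y) ax≡ay ⟩
      a * y - a * y     ≡⟨ -‿inverseʳ (a * y) ⟩
      0#                ∎
  ... | inj₁ a≡0   = contradiction a≡0 a≢0
  ... | inj₂ x-y≡0 = x∙y⁻¹≈ε⇒x≈y x y x-y≡0

  *-cancelʳ : ∀ {a x y} → a ≢ 0# → x * a ≡ y * a → x ≡ y
  *-cancelʳ {a} {x} {y} a≢0 xa≡ya = *-cancelˡ a≢0 (trans (*-comm a x) (trans xa≡ya (*-comm y a)))

  x*x≡y*y⇒x≡±y : ∀ {x y} → x * x ≡ y * y → x ≡ y ⊎ x ≡ - y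
  x*x≡y*y⇒x≡±y {x} {y} xx≡yy with x*y≡0⇒x≡0⊎y≡0 {x - y} {x + y} [x-y][x+y]≡0
    where
    [x-y][x+y]≡0 : (x - y) * (x + y) ≡ 0#
    [x-y][x+y]≡0 = begin
      (x - y) * (x + y)   ≡⟨ solve 2 (λ x y → (x :- y) :* (x :+ y) := x :* x :- y :* y) refl x y ⟩
      x * x - y * y       ≡⟨ cong (_- y * y) xx≡yy ⟩
      y * y - y * y       ≡⟨ -‿inverseʳ (y * y) ⟩
      0#                  ∎
  ... | inj₁ x-y≡0 = inj₁ (x∙y⁻¹≈ε⇒x≈y x y x-y≡0)
  ... | inj₂ x+y≡0 = inj₂ (+-inverseˡ-unique x y x+y≡0)

  -- The junk value 0⁻¹ = 0 makes _⁻¹ total.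
  _⁻¹ : Carrier → Carrier
  x ⁻¹ with x ≟ 0#
  ... | yes _   = 0#
  ... | no  x≢0 = proj₁ (inverse x x≢0)

  x*x⁻¹≡1 : ∀ {x} → x ≢ 0# → x * x ⁻¹ ≡ 1#
  x*x⁻¹≡1 {x} x≢0 with x ≟ 0#
  ... | yes x≡0  = contradiction x≡0 x≢0
  ... | no  x≢0′ = proj₂ (inverse x x≢0′)

  x*y≡1⇒x≢0 : ∀ {x y} → x * y ≡ 1# → x ≢ 0#
  x*y≡1⇒x≢0 {x} {y} xy≡1 x≡0 = 0≢1 (trans (sym (zeroˡ y)) (trans (cong (_* y) (sym x≡0)) xy≡1))

  x*y≡1⇒y≡x⁻¹ : ∀ {x y} → x * y ≡ 1# → y ≡ x ⁻¹
  x*y≡1⇒y≡x⁻¹ xy≡1 = *-cancelˡ (x*y≡1⇒x≢0 xy≡1) (trans xy≡1 (sym (x*x⁻¹≡1 (x*y≡1⇒x≢0 xy≡1))))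

  ⁻¹-≢0 : ∀ {x} → x ≢ 0# → x ⁻¹ ≢ 0#
  ⁻¹-≢0 {x} x≢0 = x*y≡1⇒x≢0 (trans (*-comm (x ⁻¹) x) (x*x⁻¹≡1 x≢0))

  ⁻¹-involutive : ∀ {x} → x ≢ 0# → x ⁻¹ ⁻¹ ≡ x
  ⁻¹-involutive {x} x≢0 = sym (x*y≡1⇒y≡x⁻¹ (trans (*-comm (x ⁻¹) x) (x*x⁻¹≡1 x≢0)))

  -‿⁻¹ : ∀ {x} → x ≢ 0# → (- x) ⁻¹ ≡ - (x ⁻¹)
  -‿⁻¹ {x} x≢0 = sym (x*y≡1⇒y≡x⁻¹ (trans (solve 2 (λ x y → (:- x) :* (:- y) := x :* y) refl x (x ⁻¹)) (x*x⁻¹≡1 x≢0)))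

  IsSquare : Pred Carrier 0ℓ
  IsSquare u = ∃ λ y → y * y ≡ u

  IsSquare? : Decidable IsSquare
  IsSquare? u = ∃? (λ y → y * y ≟ u)

  NonzeroSquare : Pred Carrier 0ℓ
  NonzeroSquare u = u ≢ 0# × IsSquare u

  NonzeroSquare? : Decidable NonzeroSquare
  NonzeroSquare? u = ¬? (u ≟ 0#) ×-dec IsSquare? u

  IsSquare-* : ∀ {a b} → IsSquare a → IsSquare b → IsSquare (a * b)
  IsSquare-* (y , refl) (z , refl) = y * z , solve 2 (λ y z → (y :* z) :* (y :* z) := (y :* y) :* (z :* z)) refl y z

  IsSquare-cancelˡ : ∀ {a b} → NonzeroSquare a → IsSquare (a * b) → IsSquare b
  IsSquare-cancelˡ {b = b} (a≢0 , y , refl) (z , zz≡yyb) = z * y ⁻¹ , (begin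
    (z * y ⁻¹) * (z * y ⁻¹)
      ≡⟨ solve 2 (λ z w → (z :* w) :* (z :* w) := (z :* z) :* (w :* w)) refl z (y ⁻¹) ⟩
    (z * z) * (y ⁻¹ * y ⁻¹)
      ≡⟨ cong (_* (y ⁻¹ * y ⁻¹)) zz≡yyb ⟩
    ((y * y) * b) * (y ⁻¹ * y ⁻¹)
      ≡⟨ solve 3 (λ y w b → ((y :* y) :* b) :* (w :* w) := b :* ((y :* w) :* (y :* w))) refl y (y ⁻¹) b ⟩
    b * ((y * y ⁻¹) * (y * y ⁻¹))
      ≡⟨ cong (λ e → b * (e * e)) (x*x⁻¹≡1 y≢0) ⟩
    b * (1# * 1#)
      ≡⟨ solve 1 (λ b → b :* (:1 :* :1) := b) refl b ⟩
    b ∎)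
    where
    y≢0 : y ≢ 0#
    y≢0 = x*x≢0⇒x≢0 a≢0

module NatArithmetic where

  open import Data.Nat using (_+_; _*_; _%_)
  open ≡ using (refl; trans; cong)
  open ≡.≡-Reasoning
  open ℕ-Solver

  ≢-mod : ∀ {a x b y} n .{{_ : ℕ.NonZero n}} → a % n ≢ b % n → a + x * n ≢ b + y * n
  ≢-mod {a} {x} {b} {y} n a≢b e = a≢b (begin
    a % n               ≡⟨ [m+kn]%n≡m%n a x n ⟨
    (a + x * n) % n     ≡⟨ cong (_% n) e ⟩
    (b + y * n) % n     ≡⟨ [m+kn]%n≡m%n b y n ⟩
    b % n               ∎)

  5+8c≢m+m : ∀ c m → 5 + c * 8 ≢ m + m
  5+8c≢m+m c m e = ≢-mod {1} {2 + c * 4} {0} {m} 2 (λ ()) (begin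
    1 + (2 + c * 4) * 2   ≡⟨ solve 1 (λ c → con 1 :+ (con 2 :+ c :* con 4) :* con 2 := con 5 :+ c :* con 8) refl c ⟩
    5 + c * 8             ≡⟨ e ⟩
    m + m                 ≡⟨ solve 1 (λ m → m :+ m := con 0 :+ m :* con 2) refl m ⟩
    0 + m * 2             ∎)

  5+8c≢3+4m : ∀ c m → 5 + c * 8 ≢ 3 + 4 * m
  5+8c≢3+4m c m e = ≢-mod {1} {1 + c * 2} {3} {m} 4 (λ ()) (begin
    1 + (1 + c * 2) * 4   ≡⟨ solve 1 (λ c → con 1 :+ (con 1 :+ c :* con 2) :* con 4 := con 5 :+ c :* con 8) refl c ⟩
    5 + c * 8             ≡⟨ e ⟩
    3 + 4 * m             ≡⟨ cong (λ k → 3 + k) (ℕP.*-comm 4 m) ⟩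
    3 + m * 4             ∎)

  5+8c≢1+8m : ∀ c m → 5 + c * 8 ≢ 1 + (4 * m + 4 * m)
  5+8c≢1+8m c m e = ≢-mod {5} {c} {1} {m} 8 (λ ())
    (trans e (solve 1 (λ m → con 1 :+ (con 4 :* m :+ con 4 :* m) := con 1 :+ m :* con 8) refl m))

  3+2[2+2d]≡7+4d : ∀ d → 3 + ((2 + (d + d)) + (2 + (d + d))) ≡ 7 + 4 * d
  3+2[2+2d]≡7+4d = solve 1 (λ d → con 3 :+ ((con 2 :+ (d :+ d)) :+ (con 2 :+ (d :+ d))) := con 7 :+ con 4 :* d) refl

module FiveModEight {q : ℕ} (F : FiniteField q) {c : ℕ} (q≡5+8c : q ≡ 5 ℕ.+ c ℕ.* 8) where

  open FieldProperties F
  open Counting using (HasSize-resp; HasSize-unique; HasSize-≡; HasSize-∪; injection⇒bijection; Bijection)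
  open FreeInvolutions
  open NatArithmetic
  open ≡ using (refl; sym; trans; cong; subst)
  open ≡.≡-Reasoning

  2≢0 : 2# ≢ 0#
  2≢0 2≡0 = let (m , _ , q≡m+m) = Shift.HasSize-even enumeration (λ _ → yes tt) HasSize-U in
    5+8c≢m+m c m (trans (sym q≡5+8c) q≡m+m)
    where
    x+1+1≡x : ∀ x → (x + 1#) + 1# ≡ x
    x+1+1≡x x = trans (+-assoc x 1# 1#) (trans (cong (x +_) 2≡0) (+-identityʳ x))
    x+1≢x : ∀ x → x + 1# ≢ x
    x+1≢x x x+1≡x = 0≢1 (sym (+-cancelˡ x 1# 0# (trans x+1≡x (sym (+-identityʳ x)))))
    module Shift = FreeInvolution U (_+ 1#) index _ (λ {x} _ → x+1+1≡x x) (λ {x} _ → x+1≢x x ∘ index-injective)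

  -x≢x : ∀ {x} → x ≢ 0# → - x ≢ x
  -x≢x {x} x≢0 -x≡x = *-≢0 2≢0 x≢0 (begin
    2# * x      ≡⟨ solve 1 (λ x → :2 :* x := x :+ x) refl x ⟩
    x + x       ≡⟨ cong (_+ x) -x≡x ⟨
    - x + x     ≡⟨ -‿inverseˡ x ⟩
    0#          ∎)

  module Negation (P : Pred Carrier 0ℓ) (P-neg : ∀ {x} → P x → P (- x)) (P⇒≢0 : ∀ {x} → P x → x ≢ 0#) =
    FreeInvolution P -_ index P-neg (λ _ → -‿involutive _) (λ px → -x≢x (P⇒≢0 px) ∘ index-injective)

  1≢-1 : 1# ≢ - 1#
  1≢-1 = -x≢x (0≢1 ∘ sym) ∘ sym

  PlusMinusOne : Pred Carrier 0ℓ
  PlusMinusOne x = x ≡ 1# ⊎ x ≡ - 1#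

  HasSize-±1 : HasSize PlusMinusOne 2
  HasSize-±1 = HasSize-∪ (HasSize-≡ 1#) (HasSize-≡ (- 1#)) (λ (x≡1 , x≡-1) → 1≢-1 (trans (sym x≡1) x≡-1))

  x*x≡1⇒x≡±1 : ∀ {x} → x * x ≡ 1# → PlusMinusOne x
  x*x≡1⇒x≡±1 xx≡1 = x*x≡y*y⇒x≡±y (trans xx≡1 (sym (*-identityˡ 1#)))

  ±1*±1≡1 : ∀ {x} → PlusMinusOne x → x * x ≡ 1#
  ±1*±1≡1 (inj₁ refl) = *-identityˡ 1#
  ±1*±1≡1 (inj₂ refl) = trans (-x*-x 1#) (*-identityˡ 1#)

  NonSelfInverse : Pred Carrier 0ℓ
  NonSelfInverse x = x ≢ 0# × x * x ≢ 1#

  NonSelfInverse? : Decidable NonSelfInverse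
  NonSelfInverse? x = ¬? (x ≟ 0#) ×-dec ¬? (x * x ≟ 1#)

  q≡3+NonSelfInverse : ∀ {n} → HasSize NonSelfInverse n → q ≡ 3 ℕ.+ n
  q≡3+NonSelfInverse e = HasSize-unique HasSize-U
    (HasSize-resp (_ , split) (HasSize-∪ (HasSize-≡ 0#) (HasSize-∪ HasSize-±1 e ±1⊥N) 0⊥rest))
    where
    ±1⊥N : PlusMinusOne ⊥ NonSelfInverse
    ±1⊥N (±1 , _ , xx≢1) = xx≢1 (±1*±1≡1 ±1)
    0⊥rest : (_≡ 0#) ⊥ (PlusMinusOne ∪ NonSelfInverse)
    0⊥rest (refl , inj₁ (inj₁ 0≡1)) = 0≢1 0≡1
    0⊥rest (refl , inj₁ (inj₂ 0≡-1)) = -1≢0 (sym 0≡-1)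
    0⊥rest (refl , inj₂ (0≢0 , _)) = 0≢0 refl
    split : ∀ {x} → U x → ((_≡ 0#) ∪ (PlusMinusOne ∪ NonSelfInverse)) x
    split {x} _ with x ≟ 0# | x * x ≟ 1#
    ... | yes x≡0 | _        = inj₁ x≡0
    ... | no x≢0  | yes xx≡1 = inj₂ (inj₁ (x*x≡1⇒x≡±1 xx≡1))
    ... | no x≢0  | no xx≢1  = inj₂ (inj₂ (x≢0 , xx≢1))

  NonSelfInverse-neg : ∀ {x} → NonSelfInverse x → NonSelfInverse (- x)
  NonSelfInverse-neg {x} (x≢0 , xx≢1) = -‿≢0 x≢0 , xx≢1 ∘ trans (sym (-x*-x x))

  x⁻¹≡x⇒x*x≡1 : ∀ {x} → x ≢ 0# → x ⁻¹ ≡ x → x * x ≡ 1#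
  x⁻¹≡x⇒x*x≡1 {x} x≢0 x⁻¹≡x = trans (cong (x *_) (sym x⁻¹≡x)) (x*x⁻¹≡1 x≢0)

  NonSelfInverse-⁻¹ : ∀ {x} → NonSelfInverse x → NonSelfInverse (x ⁻¹)
  NonSelfInverse-⁻¹ {x} (x≢0 , xx≢1) = ⁻¹-≢0 x≢0 , λ x⁻¹x⁻¹≡1 →
    xx≢1 (x⁻¹≡x⇒x*x≡1 x≢0 (trans (x*y≡1⇒y≡x⁻¹ x⁻¹x⁻¹≡1) (⁻¹-involutive x≢0)))

  -- Without a square root of -1, x ↦ -x and x ↦ x⁻¹ generate a free action of order 4.
  no-√-1⇒q≡3+4m : ¬ IsSquare (- 1#) → ∃ λ m → q ≡ 3 ℕ.+ 4 ℕ.* m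
  no-√-1⇒q≡3+4m no-√-1 =
    let (n , e) = HasSize-decidable NonSelfInverse?
        (m , n≡4m) = Inversion.HasSize-four e in
    m , trans (q≡3+NonSelfInverse e) (cong (λ k → 3 ℕ.+ k) n≡4m)
    where
    x⁻¹≢-x : ∀ {x} → NonSelfInverse x → x ⁻¹ ≢ - x
    x⁻¹≢-x {x} (x≢0 , _) x⁻¹≡-x = no-√-1 (x , -‿injective (begin
      - (x * x)      ≡⟨ solve 1 (λ x → :- (x :* x) := x :* (:- x)) refl x ⟩
      x * (- x)      ≡⟨ cong (x *_) x⁻¹≡-x ⟨
      x * x ⁻¹       ≡⟨ x*x⁻¹≡1 x≢0 ⟩
      1#             ≡⟨ -‿involutive 1# ⟨
      - (- 1#)       ∎))
    module Inversion = FreeActionOfOrder4 enumeration NonSelfInverse? -_ _⁻¹ NonSelfInverse-neg NonSelfInverse-⁻¹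
      (λ _ → -‿involutive _) (-‿⁻¹ ∘ proj₁) (λ (x≢0 , _) → inj₁ (⁻¹-involutive x≢0)) (-x≢x ∘ proj₁)
      (λ (x≢0 , xx≢1) → xx≢1 ∘ x⁻¹≡x⇒x*x≡1 x≢0) x⁻¹≢-x

  √-1 : IsSquare (- 1#)
  √-1 with IsSquare? (- 1#)
  ... | yes found = found
  ... | no  none  = let (m , q≡3+4m) = no-√-1⇒q≡3+4m none in
    contradiction (trans (sym q≡5+8c) q≡3+4m) (5+8c≢3+4m c m)

  i : Carrier
  i = proj₁ √-1

  i*i≡-1 : i * i ≡ - 1#
  i*i≡-1 = proj₂ √-1

  -- Identities involving i are given to the solver as L = R + c (i² + 1), with c found by hand.
  modulo-i²+1 : ∀ {L R} c → L ≡ R + c * (i * i + 1#) → L ≡ R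
  modulo-i²+1 {L} {R} c L≡R+c[i²+1] = begin
    L                      ≡⟨ L≡R+c[i²+1] ⟩
    R + c * (i * i + 1#)   ≡⟨ cong (λ e → R + c * (e + 1#)) i*i≡-1 ⟩
    R + c * (- 1# + 1#)    ≡⟨ cong (λ e → R + c * e) (-‿inverseˡ 1#) ⟩
    R + c * 0#             ≡⟨ cong (R +_) (zeroʳ c) ⟩
    R + 0#                 ≡⟨ +-identityʳ R ⟩
    R                      ∎

  i≢0 : i ≢ 0#
  i≢0 i≡0 = -1≢0 (trans (sym i*i≡-1) (trans (cong (_* i) i≡0) (zeroˡ i)))

  i≢±1 : ¬ PlusMinusOne i
  i≢±1 ±1 = 1≢-1 (trans (sym (±1*±1≡1 ±1)) i*i≡-1)

  IsSquare-neg : ∀ {x} → IsSquare x → IsSquare (- x)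
  IsSquare-neg {x} sq = subst IsSquare (solve 1 (λ x → :- :1 :* x := :- x) refl x) (IsSquare-* √-1 sq)

  NonzeroSquare-neg : ∀ {x} → NonzeroSquare x → NonzeroSquare (- x)
  NonzeroSquare-neg (x≢0 , sq) = -‿≢0 x≢0 , IsSquare-neg sq

  squares : ℕ
  squares = proj₁ (HasSize-decidable NonzeroSquare?)

  HasSize-NonzeroSquare : HasSize NonzeroSquare squares
  HasSize-NonzeroSquare = proj₂ (HasSize-decidable NonzeroSquare?)

  HasSize-≢0 : HasSize (_≢ 0#) (squares ℕ.+ squares)
  HasSize-≢0 = Nonzero.HasSize-2-to-1 (λ x → x * x) (λ x≢0 → *-≢0 x≢0 x≢0 , _ , refl) (λ {x} _ → -x*-x x)
    (λ _ _ xx≡yy → x*x≡y*y⇒x≡±y (sym xx≡yy)) (λ (u≢0 , y , yy≡u) → y , x*x≢0⇒x≢0 (u≢0 ∘ trans (sym yy≡u)) , yy≡u)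
    HasSize-NonzeroSquare
    where
    module Nonzero = Negation (_≢ 0#) -‿≢0 id

  q≡1+2s : q ≡ 1 ℕ.+ (squares ℕ.+ squares)
  q≡1+2s = HasSize-unique HasSize-U
    (HasSize-resp (_ , split) (HasSize-∪ (HasSize-≡ 0#) HasSize-≢0 λ (x≡0 , x≢0) → x≢0 x≡0))
    where
    split : ∀ {x} → U x → ((_≡ 0#) ∪ (_≢ 0#)) x
    split {x} _ with x ≟ 0#
    ... | yes x≡0 = inj₁ x≡0
    ... | no  x≢0 = inj₂ x≢0

  -- If i were a square, multiplication by i would act freely with order 4 on the nonzero squares,
  -- whose number is (q - 1)/2.
  i-nonsquare : ¬ IsSquare i
  i-nonsquare i-square = let (m , squares≡4m) = Rotation.HasSize-four HasSize-NonzeroSquare in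
    5+8c≢1+8m c m (trans (sym q≡5+8c) (trans q≡1+2s (cong (λ k → 1 ℕ.+ (k ℕ.+ k)) squares≡4m)))
    where
    module Rotation = FreeActionOfOrder4 enumeration NonzeroSquare? -_ (i *_) NonzeroSquare-neg
      (λ (x≢0 , sq) → *-≢0 i≢0 x≢0 , IsSquare-* i-square sq) (λ _ → -‿involutive _)
      (λ {x} _ → solve 2 (λ i x → i :* (:- x) := :- (i :* x)) refl i x)
      (λ {x} _ → inj₂ (modulo-i²+1 x (solve 2 (λ i x → i :* (i :* x) := :- x :+ x :* (i :* i :+ :1)) refl i x)))
      (-x≢x ∘ proj₁)
      (λ (x≢0 , _) ix≡x → i≢±1 (inj₁ (*-cancelʳ x≢0 (trans ix≡x (sym (*-identityˡ _))))))
      (λ {x} (x≢0 , _) ix≡-x → i≢±1 (inj₂ (*-cancelʳ x≢0 (trans ix≡-x (solve 1 (λ x → :- x := :- :1 :* x) refl x)))))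

  NonSquare : Pred Carrier 0ℓ
  NonSquare u = u ≢ 0# × ¬ IsSquare u

  HasSize-NonSquare : HasSize NonSquare squares
  HasSize-NonSquare = subst (HasSize NonSquare) t≡squares eN
    where
    NonSquare? : Decidable NonSquare
    NonSquare? u = ¬? (u ≟ 0#) ×-dec ¬? (IsSquare? u)
    t : ℕ
    t = proj₁ (HasSize-decidable NonSquare?)
    eN : HasSize NonSquare t
    eN = proj₂ (HasSize-decidable NonSquare?)
    split : ∀ {x} → x ≢ 0# → (NonzeroSquare ∪ NonSquare) x
    split {x} x≢0 with IsSquare? x
    ... | yes sq  = inj₁ (x≢0 , sq)
    ... | no  ¬sq = inj₂ (x≢0 , ¬sq)
    t≡squares : t ≡ squares
    t≡squares = ℕP.+-cancelˡ-≡ squares t squares (HasSize-unique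
      (HasSize-resp ([ proj₁ , proj₁ ]′ , split) (HasSize-∪ HasSize-NonzeroSquare eN λ ((_ , sq) , (_ , ¬sq)) → ¬sq sq))
      HasSize-≢0)

  NonSquare-i* : ∀ {x} → NonzeroSquare x → NonSquare (i * x)
  NonSquare-i* {x} nzsq@(x≢0 , _) = *-≢0 i≢0 x≢0 , λ ix-square →
    i-nonsquare (IsSquare-cancelˡ nzsq (subst IsSquare (*-comm i x) ix-square))

  -- Multiplication by i maps the nonzero squares injectively into the equally many non-squares.
  NonSquare⇒IsSquare-i* : ∀ {u} → NonSquare u → IsSquare (i * u)
  NonSquare⇒IsSquare-i* nsq = let (x , (_ , y , yy≡x) , ix≡u) = Bijection.to-onto times-i nsq in
    i * y , (begin
      (i * y) * (i * y)   ≡⟨ solve 2 (λ i y → (i :* y) :* (i :* y) := i :* (i :* (y :* y))) refl i y ⟩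
      i * (i * (y * y))   ≡⟨ cong (λ e → i * (i * e)) yy≡x ⟩
      i * (i * x)         ≡⟨ cong (i *_) ix≡u ⟩
      i * _               ∎)
    where
    times-i : Bijection NonzeroSquare NonSquare
    times-i = injection⇒bijection HasSize-NonzeroSquare HasSize-NonSquare (i *_) NonSquare-i* (λ _ _ → *-cancelˡ i≢0)

module Dynamics {q : ℕ} (F : FiniteField q) {c : ℕ} (q≡5+8c : q ≡ 5 ℕ.+ c ℕ.* 8) where

  open FieldProperties F
  open FiveModEight F {c} q≡5+8c
  open FieldDefs F using (InT; _↦_; Adv; AdvInf)
  open ≡ using (refl; sym; trans; cong; cong₂; subst)
  open ≡.≡-Reasoning

  ½ : Carrier
  ½ = 2# ⁻¹

  2*½≡1 : 2# * ½ ≡ 1#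
  2*½≡1 = x*x⁻¹≡1 2≢0

  v : Carrier → Carrier
  v s = 2# * s * (1# + s * s)

  Good : Pred Carrier 0ℓ
  Good s = InT (s * s) × IsSquare (v s)

  HasGoodRoot : Pred Carrier 0ℓ
  HasGoodRoot k = ∃ λ s → Good s × s * s ≡ k

  InT-neg : ∀ {k} → InT k → InT (- k)
  InT-neg {k} (k≢0 , k≢1 , k≢-1) =
    -‿≢0 k≢0 , (λ -k≡1 → k≢-1 (trans (sym (-‿involutive k)) (cong -_ -k≡1))) , k≢1 ∘ -‿injective

  v≢0 : ∀ {s} → InT (s * s) → v s ≢ 0#
  v≢0 (ss≢0 , _ , ss≢-1) = *-≢0 (*-≢0 2≢0 (x*x≢0⇒x≢0 ss≢0)) (1+x≢0 ss≢-1)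

  ↦-root : ∀ {a b} → (1# + a) * (1# + a) * (b * b) ≡ 4# * a → (½ * ((1# + a) * b)) * (½ * ((1# + a) * b)) ≡ a
  ↦-root {a} {b} arrow = begin
    (½ * ((1# + a) * b)) * (½ * ((1# + a) * b))
      ≡⟨ solve 3 (λ h A b → (h :* (A :* b)) :* (h :* (A :* b)) := (h :* h) :* (A :* A :* (b :* b))) refl ½ (1# + a) b ⟩
    (½ * ½) * ((1# + a) * (1# + a) * (b * b))
      ≡⟨ cong ((½ * ½) *_) arrow ⟩
    (½ * ½) * (4# * a)
      ≡⟨ solve 2 (λ h a → (h :* h) :* (:4 :* a) := ((:2 :* h) :* (:2 :* h)) :* a) refl ½ a ⟩
    ((2# * ½) * (2# * ½)) * a
      ≡⟨ cong (λ e → (e * e) * a) 2*½≡1 ⟩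
    (1# * 1#) * a
      ≡⟨ solve 1 (λ a → (:1 :* :1) :* a := a) refl a ⟩
    a ∎

  adv₂⇒HasGoodRoot : ∀ {k} → Adv 2 k → HasGoodRoot k
  adv₂⇒HasGoodRoot {k} (k₁ , (Tk , _ , arrow₁) , k₂ , (_ , _ , arrow₂) , _) =
    s , (subst InT (sym ss≡k) Tk , w * (1# + k) , sym vs≡[w[1+k]]²) , ss≡k
    where
    s w : Carrier
    s = ½ * ((1# + k) * k₁)
    w = ½ * ((1# + k₁) * k₂)
    ss≡k : s * s ≡ k
    ss≡k = ↦-root arrow₁
    vs≡[w[1+k]]² : v s ≡ (w * (1# + k)) * (w * (1# + k))
    vs≡[w[1+k]]² = begin
      2# * s * (1# + s * s)
        ≡⟨ cong (λ e → 2# * s * (1# + e)) ss≡k ⟩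
      2# * s * (1# + k)
        ≡⟨ solve 4 (λ two h X k₁ → two :* (h :* (X :* k₁)) :* X := (two :* h) :* (k₁ :* (X :* X))) refl 2# ½ (1# + k) k₁ ⟩
      (2# * ½) * (k₁ * ((1# + k) * (1# + k)))
        ≡⟨ cong (_* (k₁ * ((1# + k) * (1# + k)))) 2*½≡1 ⟩
      1# * (k₁ * ((1# + k) * (1# + k)))
        ≡⟨ *-identityˡ _ ⟩
      k₁ * ((1# + k) * (1# + k))
        ≡⟨ cong (_* ((1# + k) * (1# + k))) (↦-root arrow₂) ⟨
      (w * w) * ((1# + k) * (1# + k))
        ≡⟨ solve 2 (λ w X → (w :* w) :* (X :* X) := (w :* X) :* (w :* X)) refl w (1# + k) ⟩
      (w * (1# + k)) * (w * (1# + k)) ∎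

  -- For s² ∈ T, the k′ with s² ↦ k′ are ±T, where (1 + s²) T = 2s.
  module Ratio {s T : Carrier} (Tss : InT (s * s)) (D*T≡2s : (1# + s * s) * T ≡ 2# * s) where

    D : Carrier
    D = 1# + s * s

    arrow : D * D * (T * T) ≡ 4# * (s * s)
    arrow = begin
      D * D * (T * T)          ≡⟨ solve 2 (λ D T → D :* D :* (T :* T) := (D :* T) :* (D :* T)) refl D T ⟩
      (D * T) * (D * T)        ≡⟨ cong (λ e → e * e) D*T≡2s ⟩
      (2# * s) * (2# * s)      ≡⟨ solve 1 (λ s → (:2 :* s) :* (:2 :* s) := :4 :* (s :* s)) refl s ⟩
      4# * (s * s)             ∎

    T≢0 : T ≢ 0#
    T≢0 T≡0 with x*y≡0⇒x≡0⊎y≡0 (trans (sym D*T≡2s) (trans (cong (D *_) T≡0) (zeroʳ D)))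
    ... | inj₁ 2≡0 = 2≢0 2≡0
    ... | inj₂ s≡0 = x*x≢0⇒x≢0 (proj₁ Tss) s≡0

    T≢±1 : ¬ PlusMinusOne T
    T≢±1 ±1 = proj₁ (proj₂ Tss) (begin
      s * s     ≡⟨ cong (λ e → e * e) (x∙y⁻¹≈ε⇒x≈y s T s-T≡0) ⟩
      T * T     ≡⟨ ±1*±1≡1 ±1 ⟩
      1#        ∎)
      where
      s-T≡0 : s - T ≡ 0#
      s-T≡0 = x*x≡0⇒x≡0 (begin
        (s - T) * (s - T)
          ≡⟨ solve 2 (λ s T → (s :- T) :* (s :- T) := (s :* s :+ T :* T) :- (:2 :* s) :* T) refl s T ⟩
        (s * s + T * T) - 2# * s * T
          ≡⟨ cong₂ (λ a b → (s * s + a) - b * T) (±1*±1≡1 ±1) (sym D*T≡2s) ⟩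
        (s * s + 1#) - D * T * T
          ≡⟨ solve 2 (λ s T → (s :* s :+ :1) :- (:1 :+ s :* s) :* T :* T := (:1 :+ s :* s) :* (:1 :- T :* T)) refl s T ⟩
        D * (1# - T * T)
          ≡⟨ cong (λ e → D * (1# - e)) (±1*±1≡1 ±1) ⟩
        D * (1# - 1#)
          ≡⟨ cong (D *_) (-‿inverseʳ 1#) ⟩
        D * 0#
          ≡⟨ zeroʳ D ⟩
        0# ∎)

    InT-T : InT T
    InT-T = T≢0 , T≢±1 ∘ inj₁ , T≢±1 ∘ inj₂

    1-T²-square : IsSquare (1# - T * T)
    1-T²-square = (1# - s * s) * D ⁻¹ , (begin
      ((1# - s * s) * D ⁻¹) * ((1# - s * s) * D ⁻¹)
        ≡⟨ solve 2 (λ a e → (a :* e) :* (a :* e) := (a :* a) :* (e :* e)) refl (1# - s * s) (D ⁻¹) ⟩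
      ((1# - s * s) * (1# - s * s)) * (D ⁻¹ * D ⁻¹)
        ≡⟨ cong (_* (D ⁻¹ * D ⁻¹)) [1-s²]²≡D²[1-T²] ⟩
      (D * D * (1# - T * T)) * (D ⁻¹ * D ⁻¹)
        ≡⟨ solve 3 (λ D X e → (D :* D :* X) :* (e :* e) := X :* ((D :* e) :* (D :* e))) refl D (1# - T * T) (D ⁻¹) ⟩
      (1# - T * T) * ((D * D ⁻¹) * (D * D ⁻¹))
        ≡⟨ cong (λ e → (1# - T * T) * (e * e)) (x*x⁻¹≡1 (1+x≢0 (proj₂ (proj₂ Tss)))) ⟩
      (1# - T * T) * (1# * 1#)
        ≡⟨ solve 1 (λ X → X :* (:1 :* :1) := X) refl (1# - T * T) ⟩
      1# - T * T ∎)
      where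
      [1-s²]²≡D²[1-T²] : (1# - s * s) * (1# - s * s) ≡ D * D * (1# - T * T)
      [1-s²]²≡D²[1-T²] = begin
        (1# - s * s) * (1# - s * s)
          ≡⟨ solve 1 (λ s → (:1 :- s :* s) :* (:1 :- s :* s) := (:1 :+ s :* s) :* (:1 :+ s :* s) :- (:2 :* s) :* (:2 :* s)) refl s ⟩
        D * D - (2# * s) * (2# * s)
          ≡⟨ cong (λ e → D * D - e * e) D*T≡2s ⟨
        D * D - (D * T) * (D * T)
          ≡⟨ solve 2 (λ D T → D :* D :- (D :* T) :* (D :* T) := D :* D :* (:1 :- T :* T)) refl D T ⟩
        D * D * (1# - T * T) ∎

  module Step {s y : Carrier} (Tss : InT (s * s)) (yy≡vs : y * y ≡ v s) where

    t : Carrier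
    t = y * (1# + s * s) ⁻¹

    D*tt≡2s : (1# + s * s) * (t * t) ≡ 2# * s
    D*tt≡2s = begin
      D * ((y * e) * (y * e))
        ≡⟨ solve 3 (λ D y e → D :* ((y :* e) :* (y :* e)) := (y :* y) :* (e :* e :* D)) refl D y e ⟩
      (y * y) * (e * e * D)
        ≡⟨ cong (_* (e * e * D)) yy≡vs ⟩
      (2# * s * D) * (e * e * D)
        ≡⟨ solve 3 (λ s D e → (:2 :* s :* D) :* (e :* e :* D) := (:2 :* s) :* ((D :* e) :* (D :* e))) refl s D e ⟩
      (2# * s) * ((D * e) * (D * e))
        ≡⟨ cong (λ x → (2# * s) * (x * x)) (x*x⁻¹≡1 (1+x≢0 (proj₂ (proj₂ Tss)))) ⟩
      (2# * s) * (1# * 1#)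
        ≡⟨ solve 1 (λ s → (:2 :* s) :* (:1 :* :1) := :2 :* s) refl s ⟩
      2# * s ∎
      where
      D e : Carrier
      D = 1# + s * s
      e = D ⁻¹

    open Ratio Tss D*tt≡2s

    [it]²≡-t² : (i * t) * (i * t) ≡ - (t * t)
    [it]²≡-t² = modulo-i²+1 (t * t)
      (solve 2 (λ i t → (i :* t) :* (i :* t) := :- (t :* t) :+ (t :* t) :* (i :* i :+ :1)) refl i t)

    InT-it : InT ((i * t) * (i * t))
    InT-it = subst InT (sym [it]²≡-t²) (InT-neg InT-T)

    arrow-it : D * D * (((i * t) * (i * t)) * ((i * t) * (i * t))) ≡ 4# * (s * s)
    arrow-it = trans (cong (λ e → D * D * (e * e)) [it]²≡-t²) (trans (cong (D * D *_) (-x*-x (t * t))) arrow)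

    i*vt*v[it] : (i * v t) * v (i * t) ≡ (i * (2# * t)) * (i * (2# * t)) * (1# - (t * t) * (t * t))
    i*vt*v[it] = modulo-i²+1 ((i * i) * 4# * (t * t) * (t * t) * (1# + t * t)) (solve 2 (λ i t →
      (i :* (:2 :* t :* (:1 :+ t :* t))) :* (:2 :* (i :* t) :* (:1 :+ (i :* t) :* (i :* t)))
        := (i :* (:2 :* t)) :* (i :* (:2 :* t)) :* (:1 :- (t :* t) :* (t :* t))
           :+ (i :* i) :* :4 :* (t :* t) :* (t :* t) :* (:1 :+ t :* t) :* (i :* i :+ :1)) refl i t)

    v[it]-square : ¬ IsSquare (v t) → IsSquare (v (i * t))
    v[it]-square ¬sq = IsSquare-cancelˡ (*-≢0 i≢0 (v≢0 InT-T) , NonSquare⇒IsSquare-i* (v≢0 InT-T , ¬sq))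
      (subst IsSquare (sym i*vt*v[it]) (IsSquare-* (_ , refl) 1-T²-square))

    next : ∃ λ k′ → ((s * s) ↦ k′) × HasGoodRoot k′
    next with IsSquare? (v t)
    ... | yes sq  = t * t , (Tss , InT-T , arrow) , t , (InT-T , sq) , refl
    ... | no  ¬sq = (i * t) * (i * t) , (Tss , InT-it , arrow-it) , i * t , (InT-it , v[it]-square ¬sq) , refl

  HasGoodRoot-step : ∀ {k} → HasGoodRoot k → ∃ λ k′ → (k ↦ k′) × HasGoodRoot k′
  HasGoodRoot-step (s , (Tss , y , yy≡vs) , refl) = Step.next Tss yy≡vs

  HasGoodRoot⇒Adv : ∀ {k} → HasGoodRoot k → ∀ n → Adv n k
  HasGoodRoot⇒Adv (s , (Tss , _) , refl) zero = Tss
  HasGoodRoot⇒Adv g (suc n) = let (k′ , k↦k′ , g′) = HasGoodRoot-step g in k′ , k↦k′ , HasGoodRoot⇒Adv g′ n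

  AdvInf≐HasGoodRoot : AdvInf ≐ HasGoodRoot
  AdvInf≐HasGoodRoot = (λ adv → adv₂⇒HasGoodRoot (adv 2)) , (λ g n → HasGoodRoot⇒Adv g n)

module PointCount {q : ℕ} (F : FiniteField q) {c : ℕ} (q≡5+8c : q ≡ 5 ℕ.+ c ℕ.* 8) where

  open FieldProperties F
  open FiveModEight F {c} q≡5+8c
  open Dynamics F {c} q≡5+8c
  open FieldDefs F using (InT; AdvInf; AffineE)
  open NatArithmetic using (3+2[2+2d]≡7+4d)
  open Counting using (HasSize-resp; HasSize-unique; HasSize-≡; HasSize-∪; Bijection; HasSize-bijection)
  open FreeInvolutions
  open ≡ using (refl; sym; trans; cong; subst)
  open ≡.≡-Reasoning

  cubic : Carrier → Carrier
  cubic x = x * x * x - x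

  cubic≡0⇒x≡0,±1 : ∀ {x} → cubic x ≡ 0# → x ≡ 0# ⊎ PlusMinusOne x
  cubic≡0⇒x≡0,±1 {x} cubic≡0
    with x*y≡0⇒x≡0⊎y≡0 {x} (trans (solve 1 (λ x → x :* ((x :- :1) :* (x :+ :1)) := x :* x :* x :- x) refl x) cubic≡0)
  ... | inj₁ x≡0 = inj₁ x≡0
  ... | inj₂ [x-1][x+1]≡0 with x*y≡0⇒x≡0⊎y≡0 [x-1][x+1]≡0
  ...   | inj₁ x-1≡0 = inj₂ (inj₁ (x∙y⁻¹≈ε⇒x≈y x 1# x-1≡0))
  ...   | inj₂ x+1≡0 = inj₂ (inj₂ (+-inverseˡ-unique x 1# x+1≡0))

  cubicSquares : ℕ
  cubicSquares = proj₁ (HasSize-decidable (NonzeroSquare? ∘ cubic))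

  HasSize-cubicSquares : HasSize (NonzeroSquare ∘ cubic) cubicSquares
  HasSize-cubicSquares = proj₂ (HasSize-decidable (NonzeroSquare? ∘ cubic))

  TwoTorsion : Pred (Carrier × Carrier) 0ℓ
  TwoTorsion p = p ≡ (0# , 0#) ⊎ (p ≡ (1# , 0#) ⊎ p ≡ (- 1# , 0#))

  HasSize-TwoTorsion : HasSize TwoTorsion 3
  HasSize-TwoTorsion = HasSize-∪ (HasSize-≡ _) (HasSize-∪ (HasSize-≡ _) (HasSize-≡ _) 1⊥-1) 0⊥±1
    where
    1⊥-1 : (_≡ (1# , 0#)) ⊥ (_≡ (- 1# , 0#))
    1⊥-1 (refl , e) = 1≢-1 (cong proj₁ e)
    0⊥±1 : (_≡ (0# , 0#)) ⊥ ((_≡ (1# , 0#)) ∪ (_≡ (- 1# , 0#)))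
    0⊥±1 (refl , inj₁ e) = 0≢1 (cong proj₁ e)
    0⊥±1 (refl , inj₂ e) = -1≢0 (sym (cong proj₁ e))

  OffAxis : Pred (Carrier × Carrier) 0ℓ
  OffAxis (x , y) = y ≢ 0# × AffineE (x , y)

  HasSize-OffAxis : HasSize OffAxis (cubicSquares ℕ.+ cubicSquares)
  HasSize-OffAxis = Reflection.HasSize-2-to-1 proj₁
    (λ (y≢0 , yy≡cubic) → (λ cubic≡0 → *-≢0 y≢0 y≢0 (trans yy≡cubic cubic≡0)) , _ , yy≡cubic)
    (λ _ → refl) fibre (λ (cubic≢0 , y , yy≡cubic) → _ , (x*x≢0⇒x≢0 (cubic≢0 ∘ trans (sym yy≡cubic)) , yy≡cubic) , refl)
    HasSize-cubicSquares
    where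
    fibre : ∀ {p p′} → OffAxis p → OffAxis p′ → proj₁ p ≡ proj₁ p′ → p′ ≡ p ⊎ p′ ≡ (proj₁ p , - proj₂ p)
    fibre {x , y} {.x , y′} (_ , yy≡cubic) (_ , y′y′≡cubic) refl =
      Sum.map (cong (x ,_)) (cong (x ,_)) (x*x≡y*y⇒x≡±y (trans y′y′≡cubic (sym yy≡cubic)))
    reflect : Carrier × Carrier → Carrier × Carrier
    reflect (x , y) = x , - y
    reflect-∈ : ∀ {p} → OffAxis p → OffAxis (reflect p)
    reflect-∈ {x , y} (y≢0 , yy≡cubic) = -‿≢0 y≢0 , trans (-x*-x y) yy≡cubic
    reflect-involutive : ∀ {p} → OffAxis p → reflect (reflect p) ≡ p
    reflect-involutive {x , y} _ = cong (x ,_) (-‿involutive y)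
    module Reflection = FreeInvolution OffAxis reflect (index ∘ proj₂) reflect-∈ reflect-involutive
      (λ (y≢0 , _) → -x≢x y≢0 ∘ index-injective)

  HasSize-AffineE : HasSize AffineE (3 ℕ.+ (cubicSquares ℕ.+ cubicSquares))
  HasSize-AffineE = HasSize-resp (join , split) (HasSize-∪ HasSize-TwoTorsion HasSize-OffAxis disjoint)
    where
    disjoint : TwoTorsion ⊥ OffAxis
    disjoint (inj₁ refl , y≢0 , _)        = y≢0 refl
    disjoint (inj₂ (inj₁ refl) , y≢0 , _) = y≢0 refl
    disjoint (inj₂ (inj₂ refl) , y≢0 , _) = y≢0 refl
    join : ∀ {p} → (TwoTorsion ∪ OffAxis) p → AffineE p
    join (inj₁ (inj₁ refl))        = solve 0 (:0 :* :0 := :0 :* :0 :* :0 :- :0) refl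
    join (inj₁ (inj₂ (inj₁ refl))) = solve 0 (:0 :* :0 := :1 :* :1 :* :1 :- :1) refl
    join (inj₁ (inj₂ (inj₂ refl))) = solve 0 (:0 :* :0 := (:- :1) :* (:- :1) :* (:- :1) :- (:- :1)) refl
    join (inj₂ (_ , on-curve))     = on-curve
    split : ∀ {p} → AffineE p → (TwoTorsion ∪ OffAxis) p
    split {x , y} on-curve with y ≟ 0#
    ... | no y≢0  = inj₂ (y≢0 , on-curve)
    ... | yes refl with cubic≡0⇒x≡0,±1 (trans (sym on-curve) (zeroˡ 0#))
    ...   | inj₁ refl        = inj₁ (inj₁ refl)
    ...   | inj₂ (inj₁ refl) = inj₁ (inj₂ (inj₁ refl))
    ...   | inj₂ (inj₂ refl) = inj₁ (inj₂ (inj₂ refl))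

  v[ix]≡[1-i]²cubic : ∀ x → v (i * x) ≡ ((1# - i) * (1# - i)) * cubic x
  v[ix]≡[1-i]²cubic x = modulo-i²+1 (2# * i * (x * x * x) - x * x * x + x) (solve 2 (λ i x →
    :2 :* (i :* x) :* (:1 :+ (i :* x) :* (i :* x))
      := ((:1 :- i) :* (:1 :- i)) :* (x :* x :* x :- x) :+ (:2 :* i :* (x :* x :* x) :- x :* x :* x :+ x) :* (i :* i :+ :1)) refl i x)

  NonzeroSquare-scale : ∀ {a u} → a ≢ 0# → NonzeroSquare u → NonzeroSquare ((a * a) * u)
  NonzeroSquare-scale a≢0 (u≢0 , sq) = *-≢0 (*-≢0 a≢0 a≢0) u≢0 , IsSquare-* (_ , refl) sq

  NonzeroSquare-unscale : ∀ {a u} → NonzeroSquare ((a * a) * u) → NonzeroSquare u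
  NonzeroSquare-unscale {a} {u} (aau≢0 , sq) = u≢0 , IsSquare-cancelˡ (aa≢0 , _ , refl) sq
    where
    u≢0 : u ≢ 0#
    u≢0 u≡0 = aau≢0 (trans (cong ((a * a) *_) u≡0) (zeroʳ (a * a)))
    aa≢0 : a * a ≢ 0#
    aa≢0 aa≡0 = aau≢0 (trans (cong (_* u) aa≡0) (zeroˡ u))

  HasSize-vSquares : HasSize (NonzeroSquare ∘ v) cubicSquares
  HasSize-vSquares = HasSize-bijection times-i HasSize-cubicSquares
    where
    1-i≢0 : 1# - i ≢ 0#
    1-i≢0 1-i≡0 = i≢±1 (inj₁ (sym (x∙y⁻¹≈ε⇒x≈y 1# i 1-i≡0)))
    i[-is]≡s : ∀ s → i * (- i * s) ≡ s
    i[-is]≡s s = modulo-i²+1 (- s) (solve 2 (λ i s → i :* (:- i :* s) := s :+ (:- s) :* (i :* i :+ :1)) refl i s)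
    times-i : Bijection (NonzeroSquare ∘ cubic) (NonzeroSquare ∘ v)
    times-i = record
      { to           = i *_
      ; to-∈         = λ {x} nzsq → subst NonzeroSquare (sym (v[ix]≡[1-i]²cubic x)) (NonzeroSquare-scale 1-i≢0 nzsq)
      ; to-injective = λ _ _ → *-cancelˡ i≢0
      ; to-onto      = λ {s} nzsq → - i * s ,
          NonzeroSquare-unscale (subst NonzeroSquare (trans (cong v (sym (i[-is]≡s s))) (v[ix]≡[1-i]²cubic (- i * s))) nzsq) ,
          i[-is]≡s s }

  Good? : Decidable Good
  Good? s = InT? (s * s) ×-dec IsSquare? (v s)
    where
    InT? : Decidable InT
    InT? k = ¬? (k ≟ 0#) ×-dec ¬? (k ≟ 1#) ×-dec ¬? (k ≟ - 1#)

  good : ℕ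
  good = proj₁ (HasSize-decidable Good?)

  HasSize-Good : HasSize Good good
  HasSize-Good = proj₂ (HasSize-decidable Good?)

  cubicSquares≡2+good : cubicSquares ≡ 2 ℕ.+ good
  cubicSquares≡2+good = HasSize-unique HasSize-vSquares
    (HasSize-resp (join , split) (HasSize-∪ HasSize-±1 HasSize-Good ±1⊥Good))
    where
    ±1⊥Good : PlusMinusOne ⊥ Good
    ±1⊥Good (±1 , (_ , ss≢1 , _) , _) = ss≢1 (±1*±1≡1 ±1)
    v1 : NonzeroSquare (v 1#)
    v1 = subst NonzeroSquare (solve 0 (:2 :* :2 := :2 :* :1 :* (:1 :+ :1 :* :1)) refl) (*-≢0 2≢0 2≢0 , 2# , refl)
    v-1 : NonzeroSquare (v (- 1#))
    v-1 = subst NonzeroSquare (sym (modulo-i²+1 (- 4#) (solve 1 (λ i →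
        :2 :* (:- :1) :* (:1 :+ (:- :1) :* (:- :1)) := (i :* :2) :* (i :* :2) :+ (:- :4) :* (i :* i :+ :1)) refl i)))
      (*-≢0 (*-≢0 i≢0 2≢0) (*-≢0 i≢0 2≢0) , i * 2# , refl)
    join : ∀ {s} → (PlusMinusOne ∪ Good) s → NonzeroSquare (v s)
    join (inj₁ (inj₁ refl))   = v1
    join (inj₁ (inj₂ refl))   = v-1
    join (inj₂ (Tss , sq))    = v≢0 Tss , sq
    split : ∀ {s} → NonzeroSquare (v s) → (PlusMinusOne ∪ Good) s
    split {s} (vs≢0 , sq) with s * s ≟ 1#
    ... | yes ss≡1 = inj₁ (x*x≡1⇒x≡±1 ss≡1)
    ... | no  ss≢1 = inj₂ ((ss≢0 , ss≢1 , ss≢-1) , sq)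
      where
      ss≢0 : s * s ≢ 0#
      ss≢0 ss≡0 = vs≢0 (trans (cong v (x*x≡0⇒x≡0 ss≡0)) (solve 0 (:2 :* :0 :* (:1 :+ :0 :* :0) := :0) refl))
      ss≢-1 : s * s ≢ - 1#
      ss≢-1 ss≡-1 = vs≢0 (trans (cong (λ e → 2# * s * (1# + e)) ss≡-1)
                                (trans (cong (2# * s *_) (-‿inverseʳ 1#)) (zeroʳ _)))

  HasGoodRoot? : Decidable HasGoodRoot
  HasGoodRoot? k = ∃? (λ s → Good? s ×-dec (s * s ≟ k))

  advInf : ℕ
  advInf = proj₁ (HasSize-decidable HasGoodRoot?)

  HasSize-AdvInf : HasSize AdvInf advInf
  HasSize-AdvInf = HasSize-resp (proj₂ AdvInf≐HasGoodRoot , proj₁ AdvInf≐HasGoodRoot)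
                                 (proj₂ (HasSize-decidable HasGoodRoot?))

  good≡advInf+advInf : good ≡ advInf ℕ.+ advInf
  good≡advInf+advInf = HasSize-unique HasSize-Good (Roots.HasSize-2-to-1 (λ s → s * s) (λ g → _ , g , refl)
    (λ {s} _ → -x*-x s) (λ _ _ ss≡tt → x*x≡y*y⇒x≡±y (sym ss≡tt)) (λ (s , g , ss≡k) → s , g , ss≡k)
    (proj₂ (HasSize-decidable HasGoodRoot?)))
    where
    Good-neg : ∀ {s} → Good s → Good (- s)
    Good-neg {s} (Tss , sq) = subst InT (sym (-x*-x s)) Tss ,
      subst IsSquare (solve 1 (λ s → :- (:2 :* s :* (:1 :+ s :* s)) := :2 :* (:- s) :* (:1 :+ (:- s) :* (:- s))) refl s)
        (IsSquare-neg sq)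
    Good⇒≢0 : ∀ {s} → Good s → s ≢ 0#
    Good⇒≢0 ((ss≢0 , _) , _) = x*x≢0⇒x≢0 ss≢0
    module Roots = Negation Good Good-neg Good⇒≢0

  HasSize-AffineE-advInf : HasSize AffineE (7 ℕ.+ 4 ℕ.* advInf)
  HasSize-AffineE-advInf = subst (HasSize AffineE) (begin
    3 ℕ.+ (cubicSquares ℕ.+ cubicSquares)            ≡⟨ cong (λ n → 3 ℕ.+ (n ℕ.+ n)) cubicSquares≡2+good ⟩
    3 ℕ.+ ((2 ℕ.+ good) ℕ.+ (2 ℕ.+ good))            ≡⟨ cong (λ n → 3 ℕ.+ ((2 ℕ.+ n) ℕ.+ (2 ℕ.+ n))) good≡advInf+advInf ⟩
    3 ℕ.+ ((2 ℕ.+ (d ℕ.+ d)) ℕ.+ (2 ℕ.+ (d ℕ.+ d)))  ≡⟨ 3+2[2+2d]≡7+4d d ⟩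
    7 ℕ.+ 4 ℕ.* d                                     ∎) HasSize-AffineE
    where
    d = advInf

open import Data.Nat using (_%_; _/_)
open import Data.Integer using (+_; _+_; _-_; _*_)
open import Data.Integer.Solver using () renaming (module +-*-Solver to ℤ-Solver)
open ≡ using (trans; cong)
open ≡.≡-Reasoning

trace-identity : ∀ q d → + 4 * + d ≡ + q - (+ q + + 1 - ((+ 7 + + 4 * + d) + + 1)) - + 7
trace-identity q d = solve 2 (λ q d →
    con (+ 4) :* d := q :- (q :+ con (+ 1) :- ((con (+ 7) :+ con (+ 4) :* d) :+ con (+ 1))) :- con (+ 7))
  ≡.refl (+ q) (+ d)
  where open ℤ-Solver

theorem3p4 : (q : ℕ) → IsPrimePower q → q % 8 ≡ 5 → (F : FiniteField q) →
    (nAff : ℕ) → HasSize (FieldDefs.AffineE F) nAff →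
    -- #E(F_q) = nAff + 1 (point at infinity), a_q = q + 1 - #E(F_q)
    Σ ℕ λ m → HasSize (FieldDefs.AdvInf F) m ×
      (+ 4) * (+ m) ≡ + q - (+ q + + 1 - (+ nAff + + 1)) - + 7
theorem3p4 q _ q%8≡5 F nAff E-size = advInf , HasSize-AdvInf , (begin
  + 4 * + advInf
    ≡⟨ trace-identity q advInf ⟩
  + q - (+ q + + 1 - ((+ 7 + + 4 * + advInf) + + 1)) - + 7
    ≡⟨ cong (λ n → + q - (+ q + + 1 - (n + + 1)) - + 7) +nAff≡7+4d ⟨
  + q - (+ q + + 1 - (+ nAff + + 1)) - + 7 ∎)
  where
  q≡5+8c : q ≡ 5 ℕ.+ (q / 8) ℕ.* 8
  q≡5+8c = trans (m≡m%n+[m/n]*n q 8) (cong (ℕ._+ (q / 8) ℕ.* 8) q%8≡5)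
  open PointCount F {q / 8} q≡5+8c
  +nAff≡7+4d : + nAff ≡ + 7 + + 4 * + advInf
  +nAff≡7+4d = trans (cong +_ (Counting.HasSize-unique E-size HasSize-AffineE-advInf))
                     (trans (ℤP.pos-+ 7 (4 ℕ.* advInf)) (cong (λ n → + 7 + n) (ℤP.pos-* 4 advInf)))
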